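{- Let $a_j=R_j(1)$ and $b_j=R_j(2)-R_j(1)$. Partition the projects into group $A=\{j\mid a_j>b_j\}$ and group $B=\{j\mid a_j\leq b_j\}$, and let $f(k)$ (resp. $g(k)$) denote the maximal revenue of allocating $k$ efforts (at most $2$ per project) to the projects of group $A$ (resp. group $B$). Then: 1. $f(k)$ equals the sum of the $k$ largest values among $\{a_i,b_i : i\in A\}$. 2. Indexing the projects of $B$ as $1,\ldots,|B|$ in descending order of $R_i(2)$, $g(k)=\sum_{i=1}^{k/2}R_i(2)$ if $k$ is even, and $g(k)=\max\left(g(k-1)+\max_{\frac{k+3}{2}\leq i\leq |B|}a_i,\; g(k+1)-\min_{1\leq i\leq \frac{k+1}{2}}b_i\right)$ if $k$ is odd, where $i$ ranges over projects in $B$.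
   Context: Resource allocation problem: maximize $\sum_{j=1}^n R_j(x_j)$ subject to $\sum_j x_j=k$, $x_j\in\{0,\ldots,m\}$, with $R_j(0)=0$. Here the special case $m=2$ is considered, and projects are sorted by $R_j(2)$ in descending order.
   Formalization: The revenues $R_j(1)$ and $R_j(2)$ are rational, so $a_j$, $b_j$, $f(k)$ and $g(k)$ take rational values. -}

module Defs where

open import Data.Nat using (ℕ; zero; suc)
open import Data.Fin using (Fin)
open import Data.Vec using (Vec; []; _∷_)
open import Data.List using (List; []; _∷_; length; foldr; concatMap; filter; reverse; take; map)
open import Data.Product using (Σ; _×_; _,_)
open import Relation.Binary.PropositionalEquality using (_≡_)
open import Data.Rational using (ℚ; 0ℚ; _+_; _-_; _≤_; _⊔_; _⊓_)
open import Data.Rational.Properties using (≤-decTotalOrder; _≤?_; _<?_)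
open import Data.List.Sort ≤-decTotalOrder using (sort)

record Project : Set where
  constructor project
  field
    R1 : ℚ
    R2 : ℚ
open Project public

a : Project → ℚ
a p = R1 p

b : Project → ℚ
b p = R2 p - R1 p

R : Project → Fin 3 → ℚ
R p Fin.zero = 0ℚ
R p (Fin.suc Fin.zero) = R1 p
R p (Fin.suc (Fin.suc Fin.zero)) = R2 p

Alloc : List Project → Set
Alloc ps = Vec (Fin 3) (length ps)

effort : (ps : List Project) → Alloc ps → ℕ
effort [] [] = zero
effort (p ∷ ps) (x ∷ xs) = Data.Fin.toℕ x Data.Nat.+ effort ps xs

revenue : (ps : List Project) → Alloc ps → ℚ
revenue [] [] = 0ℚ
revenue (p ∷ ps) (x ∷ xs) = R p x + revenue ps xs

IsMaxRevenue : List Project → ℕ → ℚ → Set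
IsMaxRevenue ps k v =
  (Σ (Alloc ps) λ x → effort ps x ≡ k × revenue ps x ≡ v)
  × (∀ (x : Alloc ps) → effort ps x ≡ k → revenue ps x ≤ v)

groupA : List Project → List Project
groupA = filter (λ p → b p <? a p)

groupB : List Project → List Project
groupB = filter (λ p → a p ≤? b p)

sumℚ : List ℚ → ℚ
sumℚ = foldr _+_ 0ℚ

sumLargest : ℕ → List ℚ → ℚ
sumLargest k xs = sumℚ (take k (reverse (sort xs)))

-- maximum / minimum of a list; only used on nonempty lists (value on [] is junk)
maxOf : List ℚ → ℚ
maxOf [] = 0ℚ
maxOf (x ∷ xs) = foldr _⊔_ x xs

minOf : List ℚ → ℚ
minOf [] = 0ℚ
minOf (x ∷ xs) = foldr _⊓_ x xs

abValues : List Project → List ℚ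
abValues = concatMap (λ p → a p ∷ b p ∷ [])

-- In group A the second effort on a project is worth b_j < a_j, so allocating k efforts amounts to
-- choosing k entries of the multiset {a_j, b_j}: a choice containing b_j but not a_j is improved by
-- swapping b_j for a_j.
-- In group B two single efforts on projects q, p with R_p(2) ≤ R_q(2) are worth a_q + a_p ≤ R_q(2)
-- (the larger of a_q, a_p is at most its own b), so an optimal allocation of 2m efforts doubles the
-- m projects with largest R(2). An allocation of 2m+1 efforts keeps one single effort, which either
-- lies after the first m projects or replaces a double among the first m+1; these two shapes give
-- the two terms of the maximum, and a simultaneous induction on the project list bounds the even
-- and the odd case.

module Submission where

open import Defs
open import Data.Nat using (ℕ; suc; _*_; _≤_; _<_; _+_)
open import Data.List using (List; length; take; drop; map)
open import Data.List.Relation.Unary.Linked using (Linked)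
open import Data.Product using (_×_)
open import Relation.Binary.PropositionalEquality using (_≡_)
open import Data.Rational using (ℚ) renaming (_≤_ to _≤ℚ_; _+_ to _+ℚ_; _-_ to _-ℚ_; _⊔_ to _⊔ℚ_)

open import Level using (Level)
open import Function using (flip; _∘_)
open import Algebra using (CommutativeMonoid)
open import Relation.Binary.Core using (Rel)
open import Relation.Binary.PropositionalEquality using (refl; sym; trans; cong; subst)
open import Data.Nat using (zero; z≤n; s≤s)
import Data.Nat.Properties as ℕₚ
open import Data.Fin using (toℕ)
open import Data.Fin.Patterns using (0F; 1F; 2F)
open import Data.Fin.Properties using (toℕ≤pred[n])
open import Data.Vec using ([]; _∷_)
open import Data.Rational using (0ℚ; -_) renaming (_<_ to _<ℚ_)
import Data.Rational.Properties as ℚₚ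
open ℚₚ using (≤-refl; ≤-trans; +-monoˡ-≤; +-monoʳ-≤; +-assoc; +-identityˡ; +-identityʳ)
open ℚₚ.≤-Reasoning
open import Data.Rational.Solver using (module +-*-Solver)
open import Algebra.Properties.CommutativeSemigroup
  (CommutativeMonoid.commutativeSemigroup ℚₚ.+-0-commutativeMonoid) using (x∙yz≈y∙xz; x∙yz≈xz∙y)
open import Data.List using ([]; _∷_; reverse; foldr)
open import Data.List.Properties using (take++drop≡id; unfold-reverse; drop-all; foldr-preservesᵒ; foldr-preservesᵇ)
open import Data.List.Membership.Propositional using (_∈_)
open import Data.List.Membership.Propositional.Properties using (∈-map⁺; ∈-map⁻; ∈-++⁺ˡ; ∈-++⁺ʳ; ∈-++⁻)
open import Data.List.Relation.Unary.Any using (here; there)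
import Data.List.Relation.Unary.Any as Any
open import Data.List.Relation.Unary.All using (All; []; _∷_)
import Data.List.Relation.Unary.All as All
open import Data.List.Relation.Unary.All.Properties using (all-filter)
open import Data.List.Relation.Unary.AllPairs using (AllPairs; []; _∷_)
import Data.List.Relation.Unary.AllPairs.Properties as AllPairs
open import Data.List.Relation.Unary.Linked.Properties using (Linked⇒AllPairs)
open import Data.List.Relation.Binary.Permutation.Propositional
  using (_↭_; prep; swap; ↭-sym) renaming (refl to ↭-refl; trans to ↭-trans)
open import Data.List.Relation.Binary.Permutation.Propositional.Properties
  using (↭-reverse; ↭-length; All-resp-↭)
open import Data.List.Sort ℚₚ.≤-decTotalOrder using (sort; sort-↭; sort-↗)
open import Data.Product using (Σ; ∃; _,_; proj₂)
open import Data.Empty using (⊥-elim)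
open import Data.Sum using (_⊎_; inj₁; inj₂; [_,_]′)

private variable
  ℓ : Level
  A : Set
  k m : ℕ
  p q : Project
  l : List Project
  r s v w y : ℚ
  xs ys : List ℚ

AllPairs-reverse : {R : Rel A ℓ} {as : List A} → AllPairs R as → AllPairs (flip R) (reverse as)
AllPairs-reverse {as = []} [] = []
AllPairs-reverse {as = x ∷ as} (x~as ∷ as!) rewrite unfold-reverse x as =
  AllPairs.++⁺ (AllPairs-reverse as!) ([] ∷ [])
    (All.map (_∷ []) (All-resp-↭ (↭-sym (↭-reverse as)) x~as))

∈-take⇒∈ : ∀ k {x : A} {as : List A} → x ∈ take k as → x ∈ as
∈-take⇒∈ k {as = as} x∈ = subst (_ ∈_) (take++drop≡id k as) (∈-++⁺ˡ x∈)

∈-drop⇒∈ : ∀ k {x : A} {as : List A} → x ∈ drop k as → x ∈ as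
∈-drop⇒∈ k {as = as} x∈ = subst (_ ∈_) (take++drop≡id k as) (∈-++⁺ʳ (take k as) x∈)

∈-drop-suc⇒∈-drop : ∀ k {x : A} {as : List A} → x ∈ drop (suc k) as → x ∈ drop k as
∈-drop-suc⇒∈-drop zero {as = _ ∷ _} x∈ = there x∈
∈-drop-suc⇒∈-drop (suc k) {as = _ ∷ _} x∈ = ∈-drop-suc⇒∈-drop k x∈

∈-take-suc : ∀ k {x : A} {as : List A} → x ∈ take (suc k) as → x ∈ take k as ⊎ x ∈ drop k as
∈-take-suc k {as = as} x∈ =
  ∈-++⁻ (take k as) (subst (_ ∈_) (sym (take++drop≡id k as)) (∈-take⇒∈ (suc k) x∈))

drop-nonempty : {as : List A} → suc k ≤ length as → ∃ λ x → x ∈ drop k as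
drop-nonempty {k = zero} {as = x ∷ _} _ = x , here refl
drop-nonempty {k = suc k} {as = _ ∷ _} (s≤s k<n) = drop-nonempty k<n

foldr-selective-∈ : {_•_ : A → A → A} → (∀ u w → (u • w ≡ u) ⊎ (u • w ≡ w)) →
                    ∀ x as → foldr _•_ x as ∈ x ∷ as
foldr-selective-∈ {_•_ = _•_} sel x as = foldr-preservesᵇ •-closed (here refl) (All.tabulate there)
  where
  •-closed : ∀ {u w} → u ∈ x ∷ as → w ∈ x ∷ as → u • w ∈ x ∷ as
  •-closed {u} {w} u∈ w∈ = [ (λ e → subst (_∈ _) (sym e) u∈) , (λ e → subst (_∈ _) (sym e) w∈) ]′ (sel u w)

-- The membership hypotheses only exclude xs = [], where maxOf and minOf return a junk 0.
maxOf-∈ : v ∈ xs → maxOf xs ∈ xs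
maxOf-∈ {xs = x ∷ xs} _ = foldr-selective-∈ ℚₚ.⊔-sel x xs

minOf-∈ : v ∈ xs → minOf xs ∈ xs
minOf-∈ {xs = x ∷ xs} _ = foldr-selective-∈ ℚₚ.⊓-sel x xs

≤-maxOf : v ∈ xs → v ≤ℚ maxOf xs
≤-maxOf {xs = x ∷ xs} v∈ = foldr-preservesᵒ (λ u w → [ ℚₚ.p≤q⇒p≤q⊔r w , ℚₚ.p≤q⇒p≤r⊔q u ]′)
  x xs (Any.toSum (Any.map ℚₚ.≤-reflexive v∈))

minOf-≤ : v ∈ xs → minOf xs ≤ℚ v
minOf-≤ {xs = x ∷ xs} v∈ = foldr-preservesᵒ (λ u w → [ ℚₚ.p≤q⇒p⊓r≤q w , ℚₚ.p≤q⇒r⊓p≤q u ]′)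
  x xs (Any.toSum (Any.map (ℚₚ.≤-reflexive ∘ sym) v∈))

maxOf-attained : (f : A → ℚ) {x : A} {as : List A} → x ∈ as → ∃ λ y → y ∈ as × maxOf (map f as) ≡ f y
maxOf-attained f x∈ = ∈-map⁻ f (maxOf-∈ (∈-map⁺ f x∈))

minOf-attained : (f : A → ℚ) {x : A} {as : List A} → x ∈ as → ∃ λ y → y ∈ as × minOf (map f as) ≡ f y
minOf-attained f x∈ = ∈-map⁻ f (minOf-∈ (∈-map⁺ f x∈))

data SubsetSum : ℕ → List ℚ → ℚ → Set where
  none : SubsetSum 0 [] 0ℚ
  skip : ∀ x → SubsetSum k xs s → SubsetSum k (x ∷ xs) s
  keep : ∀ x → SubsetSum k xs s → SubsetSum (suc k) (x ∷ xs) (x +ℚ s)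

SubsetSum-resp-↭ : xs ↭ ys → SubsetSum k xs s → SubsetSum k ys s
SubsetSum-resp-↭ ↭-refl σ = σ
SubsetSum-resp-↭ (prep x xs↭ys) (skip _ σ) = skip x (SubsetSum-resp-↭ xs↭ys σ)
SubsetSum-resp-↭ (prep x xs↭ys) (keep _ σ) = keep x (SubsetSum-resp-↭ xs↭ys σ)
SubsetSum-resp-↭ (swap x y xs↭ys) (skip _ (skip _ σ)) = skip y (skip x (SubsetSum-resp-↭ xs↭ys σ))
SubsetSum-resp-↭ (swap x y xs↭ys) (skip _ (keep _ σ)) = keep y (skip x (SubsetSum-resp-↭ xs↭ys σ))
SubsetSum-resp-↭ (swap x y xs↭ys) (keep _ (skip _ σ)) = skip y (keep x (SubsetSum-resp-↭ xs↭ys σ))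
SubsetSum-resp-↭ (swap x y xs↭ys) (keep _ (keep _ σ)) =
  subst (SubsetSum _ _) (x∙yz≈y∙xz y x _) (keep y (keep x (SubsetSum-resp-↭ xs↭ys σ)))
SubsetSum-resp-↭ (↭-trans xs↭ys ys↭zs) σ = SubsetSum-resp-↭ ys↭zs (SubsetSum-resp-↭ xs↭ys σ)

SubsetSum-zero : SubsetSum 0 xs s → s ≡ 0ℚ
SubsetSum-zero none = refl
SubsetSum-zero (skip _ σ) = SubsetSum-zero σ

SubsetSum-drop-entry : All (_≤ℚ y) xs → SubsetSum (suc k) xs s → Σ ℚ λ s′ → SubsetSum k xs s′ × s ≤ℚ y +ℚ s′
SubsetSum-drop-entry (x≤y ∷ _) (keep x σ) = _ , skip x σ , +-monoˡ-≤ _ x≤y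
SubsetSum-drop-entry (_ ∷ xs≤y) (skip x σ) with s′ , σ′ , s≤ ← SubsetSum-drop-entry xs≤y σ =
  s′ , skip x σ′ , s≤

SubsetSum≤sum-take : AllPairs (flip _≤ℚ_) xs → SubsetSum k xs s → s ≤ℚ sumℚ (take k xs)
SubsetSum≤sum-take _ none = ≤-refl
SubsetSum≤sum-take (_ ∷ xs↓) (keep x σ) = +-monoʳ-≤ x (SubsetSum≤sum-take xs↓ σ)
SubsetSum≤sum-take {k = zero} _ (skip _ σ) = ℚₚ.≤-reflexive (SubsetSum-zero σ)
SubsetSum≤sum-take {k = suc k} (xs≤x ∷ xs↓) (skip x σ) with s′ , σ′ , s≤ ← SubsetSum-drop-entry xs≤x σ =
  ≤-trans s≤ (+-monoʳ-≤ x (SubsetSum≤sum-take xs↓ σ′))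

sum-take-SubsetSum : k ≤ length xs → SubsetSum k xs (sumℚ (take k xs))
sum-take-SubsetSum {k = zero} {xs = []} _ = none
sum-take-SubsetSum {k = zero} {xs = x ∷ xs} _ = skip x (sum-take-SubsetSum z≤n)
sum-take-SubsetSum {k = suc k} {xs = x ∷ xs} (s≤s k≤n) = keep x (sum-take-SubsetSum k≤n)

module _ (xs : List ℚ) where
  private
    largestFirst : List ℚ
    largestFirst = reverse (sort xs)

    largestFirst↭xs : largestFirst ↭ xs
    largestFirst↭xs = ↭-trans (↭-reverse (sort xs)) (sort-↭ xs)

    largestFirst-descending : AllPairs (flip _≤ℚ_) largestFirst
    largestFirst-descending = AllPairs-reverse (Linked⇒AllPairs ℚₚ.≤-trans (sort-↗ xs))

  SubsetSum≤sumLargest : SubsetSum k xs s → s ≤ℚ sumLargest k xs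
  SubsetSum≤sumLargest σ =
    SubsetSum≤sum-take largestFirst-descending (SubsetSum-resp-↭ (↭-sym largestFirst↭xs) σ)

  sumLargest-SubsetSum : k ≤ length xs → SubsetSum k xs (sumLargest k xs)
  sumLargest-SubsetSum k≤n = SubsetSum-resp-↭ largestFirst↭xs
    (sum-take-SubsetSum (subst (_ ≤_) (sym (↭-length largestFirst↭xs)) k≤n))

Attains : (l : List Project) → ℕ → ℚ → Set
Attains l k v = Σ (Alloc l) λ x → effort l x ≡ k × revenue l x ≡ v

IsMaxRevenue-unique : IsMaxRevenue l k v → IsMaxRevenue l k w → v ≡ w
IsMaxRevenue-unique ((x , ex , rx) , v-max) ((y , ey , ry) , w-max) =
  ℚₚ.≤-antisym (subst (_≤ℚ _) rx (w-max x ex)) (subst (_≤ℚ _) ry (v-max y ey))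

effort≤2*length : ∀ l (x : Alloc l) → effort l x ≤ 2 * length l
effort≤2*length [] [] = z≤n
effort≤2*length (_ ∷ l) (xq ∷ xs) = subst (toℕ xq + effort l xs ≤_) (sym (ℕₚ.*-suc 2 (length l)))
  (ℕₚ.+-mono-≤ (toℕ≤pred[n] xq) (effort≤2*length l xs))

a+b≡R2 : ∀ p → a p +ℚ b p ≡ R2 p
a+b≡R2 p = solve 2 (λ x y → x :+ (y :- x) := y) refl (R1 p) (R2 p)
  where open +-*-Solver

-- Group A

InGroupA : Project → Set
InGroupA p = b p <ℚ a p

allocation-SubsetSum : ∀ l (x : Alloc l) → SubsetSum (effort l x) (abValues l) (revenue l x)
allocation-SubsetSum [] [] = none
allocation-SubsetSum (q ∷ l) (0F ∷ xs) =
  subst (SubsetSum _ _) (sym (+-identityˡ _)) (skip (a q) (skip (b q) (allocation-SubsetSum l xs)))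
allocation-SubsetSum (q ∷ l) (1F ∷ xs) = keep (a q) (skip (b q) (allocation-SubsetSum l xs))
allocation-SubsetSum (q ∷ l) (2F ∷ xs) =
  subst (SubsetSum _ _) (trans (sym (+-assoc (a q) (b q) _)) (cong (_+ℚ _) (a+b≡R2 q)))
    (keep (a q) (keep (b q) (allocation-SubsetSum l xs)))

SubsetSum-allocation : All InGroupA l → SubsetSum k (abValues l) s →
                       Σ (Alloc l) λ x → effort l x ≡ k × s ≤ℚ revenue l x
SubsetSum-allocation [] none = [] , refl , ≤-refl
SubsetSum-allocation {q ∷ l} (_ ∷ l∈A) (skip _ (skip _ σ)) with x , ex , s≤ ← SubsetSum-allocation l∈A σ =
  0F ∷ x , ex , ≤-trans s≤ (ℚₚ.≤-reflexive (sym (+-identityˡ _)))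
SubsetSum-allocation {q ∷ l} (b<a ∷ l∈A) (skip _ (keep _ σ)) with x , ex , s≤ ← SubsetSum-allocation l∈A σ =
  1F ∷ x , cong suc ex , ℚₚ.+-mono-≤ (ℚₚ.<⇒≤ b<a) s≤
SubsetSum-allocation {q ∷ l} (_ ∷ l∈A) (keep _ (skip _ σ)) with x , ex , s≤ ← SubsetSum-allocation l∈A σ =
  1F ∷ x , cong suc ex , +-monoʳ-≤ (a q) s≤
SubsetSum-allocation {q ∷ l} (_ ∷ l∈A) (keep _ (keep {s = t} _ σ))
  with x , ex , t≤ ← SubsetSum-allocation l∈A σ =
  2F ∷ x , cong (suc ∘ suc) ex , (begin
    a q +ℚ (b q +ℚ t)   ≡⟨ sym (+-assoc (a q) (b q) t) ⟩
    (a q +ℚ b q) +ℚ t   ≡⟨ cong (_+ℚ t) (a+b≡R2 q) ⟩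
    R2 q +ℚ t           ≤⟨ +-monoʳ-≤ (R2 q) t≤ ⟩
    R2 q +ℚ revenue l x ∎)

length-abValues : ∀ l → length (abValues l) ≡ 2 * length l
length-abValues [] = refl
length-abValues (_ ∷ l) = trans (cong (suc ∘ suc) (length-abValues l)) (sym (ℕₚ.*-suc 2 (length l)))

groupA-max : All InGroupA l → ∀ k → k ≤ 2 * length l → IsMaxRevenue l k (sumLargest k (abValues l))
groupA-max {l} l∈A k k≤ with x , ex , s≤ ← SubsetSum-allocation l∈A
  (sumLargest-SubsetSum (abValues l) (subst (k ≤_) (sym (length-abValues l)) k≤)) =
  (x , ex , ℚₚ.≤-antisym (upper x ex) s≤) , upper
  where
  upper : ∀ (y : Alloc l) → effort l y ≡ k → revenue l y ≤ℚ sumLargest k (abValues l)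
  upper y refl = SubsetSum≤sumLargest (abValues l) (allocation-SubsetSum l y)

-- Group B

InGroupB : Project → Set
InGroupB p = a p ≤ℚ b p

DescendingR2 : List Project → Set
DescendingR2 = AllPairs (λ p q → R2 q ≤ℚ R2 p)

prefixR2 : ℕ → List Project → ℚ
prefixR2 m l = sumℚ (map R2 (take m l))

a+r≡R2+r-b : ∀ p r → a p +ℚ r ≡ (R2 p +ℚ r) -ℚ b p
a+r≡R2+r-b p r = solve 3 (λ x y z → x :+ z := (y :+ z) :- (y :- x)) refl (R1 p) (R2 p) r
  where open +-*-Solver

w+R2-b≡w+a : ∀ w p → (w +ℚ R2 p) -ℚ b p ≡ w +ℚ a p
w+R2-b≡w+a w p = solve 3 (λ w x y → (w :+ y) :- (y :- x) := w :+ x) refl w (R1 p) (R2 p)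
  where open +-*-Solver

2*m+1≡1+2*m : ∀ m → 2 * m + 1 ≡ suc (2 * m)
2*m+1≡1+2*m m = ℕₚ.+-comm (2 * m) 1

2*m+2≡2*[1+m] : ∀ m → 2 * m + 2 ≡ 2 * suc m
2*m+2≡2*[1+m] m = trans (ℕₚ.+-comm (2 * m) 2) (sym (ℕₚ.*-suc 2 m))

1+k≡2*[1+m]⇒k≡2*m+1 : ∀ m → suc k ≡ 2 * suc m → k ≡ 2 * m + 1
1+k≡2*[1+m]⇒k≡2*m+1 m e =
  ℕₚ.suc-injective (trans e (trans (ℕₚ.*-suc 2 m) (cong suc (sym (2*m+1≡1+2*m m)))))

2+k≡2*[1+m]⇒k≡2*m : ∀ m → suc (suc k) ≡ 2 * suc m → k ≡ 2 * m
2+k≡2*[1+m]⇒k≡2*m m e = ℕₚ.suc-injective (ℕₚ.suc-injective (trans e (ℕₚ.*-suc 2 m)))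

1+k≡2*m+1⇒k≡2*m : ∀ m → suc k ≡ 2 * m + 1 → k ≡ 2 * m
1+k≡2*m+1⇒k≡2*m m e = ℕₚ.suc-injective (trans e (2*m+1≡1+2*m m))

2+k≡2*[1+m]+1⇒k≡2*m+1 : ∀ m → suc (suc k) ≡ 2 * suc m + 1 → k ≡ 2 * m + 1
2+k≡2*[1+m]+1⇒k≡2*m+1 m e =
  ℕₚ.suc-injective (ℕₚ.suc-injective (trans e (cong (_+ 1) (ℕₚ.*-suc 2 m))))

even-effort⇒≤length : ∀ l (x : Alloc l) → effort l x ≡ 2 * m → m ≤ length l
even-effort⇒≤length l x e = ℕₚ.*-cancelˡ-≤ 2 (subst (_≤ 2 * length l) e (effort≤2*length l x))

odd-effort⇒<length : ∀ l (x : Alloc l) → effort l x ≡ 2 * m + 1 → m < length l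
odd-effort⇒<length {m} l x e = ℕₚ.*-cancelˡ-< 2 m (length l)
  (subst (_≤ 2 * length l) (trans e (2*m+1≡1+2*m m)) (effort≤2*length l x))

prefixR2-suc≤ : All (λ p → R2 p ≤ℚ y) l → suc m ≤ length l → prefixR2 (suc m) l ≤ℚ y +ℚ prefixR2 m l
prefixR2-suc≤ {l = p ∷ _} {m = zero} (p≤y ∷ _) _ = +-monoˡ-≤ 0ℚ p≤y
prefixR2-suc≤ {y = y} {l = p ∷ l} {m = suc m} (_ ∷ l≤y) (s≤s m<n) = begin
  R2 p +ℚ prefixR2 (suc m) l  ≤⟨ +-monoʳ-≤ (R2 p) (prefixR2-suc≤ l≤y m<n) ⟩
  R2 p +ℚ (y +ℚ prefixR2 m l) ≡⟨ x∙yz≈y∙xz (R2 p) y _ ⟩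
  y +ℚ (R2 p +ℚ prefixR2 m l) ∎

prefixR2-mono-∷ : All (λ p → R2 p ≤ℚ R2 q) l → m ≤ length l → prefixR2 m l ≤ℚ prefixR2 m (q ∷ l)
prefixR2-mono-∷ {m = zero} _ _ = ≤-refl
prefixR2-mono-∷ {m = suc m} l≤q m<n = prefixR2-suc≤ l≤q m<n

prefixR2-suc≤prefixR2+R2 : DescendingR2 l → suc m ≤ length l → p ∈ take (suc m) l →
                           prefixR2 (suc m) l ≤ℚ prefixR2 m l +ℚ R2 p
prefixR2-suc≤prefixR2+R2 {l = q ∷ _} {m = zero} _ _ (here refl) =
  ℚₚ.≤-reflexive (trans (+-identityʳ (R2 q)) (sym (+-identityˡ (R2 q))))
prefixR2-suc≤prefixR2+R2 {l = q ∷ l} {m = suc m} (l≤q ∷ _) (s≤s m<n) (here refl) = begin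
  R2 q +ℚ prefixR2 (suc m) l     ≤⟨ +-monoʳ-≤ (R2 q) (prefixR2-suc≤ l≤q m<n) ⟩
  R2 q +ℚ (R2 q +ℚ prefixR2 m l) ≡⟨ x∙yz≈xz∙y (R2 q) (R2 q) _ ⟩
  (R2 q +ℚ prefixR2 m l) +ℚ R2 q ∎
prefixR2-suc≤prefixR2+R2 {l = q ∷ l} {m = suc m} {p = p} (_ ∷ l↓) (s≤s m<n) (there p∈) = begin
  R2 q +ℚ prefixR2 (suc m) l       ≤⟨ +-monoʳ-≤ (R2 q) (prefixR2-suc≤prefixR2+R2 l↓ m<n p∈) ⟩
  R2 q +ℚ (prefixR2 m l +ℚ R2 p)   ≡⟨ sym (+-assoc (R2 q) _ (R2 p)) ⟩
  (R2 q +ℚ prefixR2 m l) +ℚ R2 p   ∎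

prefixR2-suc-b≤prefixR2+a : DescendingR2 l → suc m ≤ length l → p ∈ take (suc m) l →
                            prefixR2 (suc m) l -ℚ b p ≤ℚ prefixR2 m l +ℚ a p
prefixR2-suc-b≤prefixR2+a {l} {m} {p} l↓ m<n p∈ = begin
  prefixR2 (suc m) l -ℚ b p          ≤⟨ +-monoˡ-≤ (- b p) (prefixR2-suc≤prefixR2+R2 l↓ m<n p∈) ⟩
  (prefixR2 m l +ℚ R2 p) -ℚ b p      ≡⟨ w+R2-b≡w+a (prefixR2 m l) p ⟩
  prefixR2 m l +ℚ a p                ∎

two-singles≤double : InGroupB q → InGroupB p → R2 p ≤ℚ R2 q → a q +ℚ a p ≤ℚ R2 q
two-singles≤double {q} {p} q∈B p∈B p≤q with ℚₚ.≤-total (a p) (a q)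
... | inj₁ ap≤aq = begin
  a q +ℚ a p ≤⟨ +-monoʳ-≤ (a q) (≤-trans ap≤aq q∈B) ⟩
  a q +ℚ b q ≡⟨ a+b≡R2 q ⟩
  R2 q       ∎
... | inj₂ aq≤ap = begin
  a q +ℚ a p ≤⟨ ℚₚ.+-mono-≤ (≤-trans aq≤ap p∈B) ≤-refl ⟩
  b p +ℚ a p ≡⟨ ℚₚ.+-comm (b p) (a p) ⟩
  a p +ℚ b p ≡⟨ a+b≡R2 p ⟩
  R2 p       ≤⟨ p≤q ⟩
  R2 q       ∎

-- Bounds by the revenue of the two shapes of an allocation of 2m+1 efforts: doubles on the first m
-- projects and a single on a later project p, or doubles on the first m+1 projects with p among
-- them downgraded to a single.
data OddBound (m : ℕ) (l : List Project) (r : ℚ) : Set where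
  outside : ∀ {p} → p ∈ drop (suc m) l → r ≤ℚ prefixR2 m l +ℚ a p → OddBound m l r
  inside  : ∀ {p} → p ∈ take (suc m) l → r ≤ℚ prefixR2 (suc m) l -ℚ b p → OddBound m l r

OddBound-weaken : DescendingR2 l → suc m ≤ length l → OddBound m l r →
                  ∃ λ p → p ∈ l × r ≤ℚ prefixR2 m l +ℚ a p
OddBound-weaken {m = m} _ _ (outside p∈ r≤) = _ , ∈-drop⇒∈ (suc m) p∈ , r≤
OddBound-weaken {m = m} l↓ m<n (inside p∈ r≤) =
  _ , ∈-take⇒∈ (suc m) p∈ , ≤-trans r≤ (prefixR2-suc-b≤prefixR2+a l↓ m<n p∈)

OddBound-∷-double : OddBound m l r → OddBound (suc m) (q ∷ l) (R2 q +ℚ r)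
OddBound-∷-double {q = q} (outside p∈ r≤) =
  outside p∈ (≤-trans (+-monoʳ-≤ (R2 q) r≤) (ℚₚ.≤-reflexive (sym (+-assoc (R2 q) _ _))))
OddBound-∷-double {q = q} (inside p∈ r≤) =
  inside (there p∈) (≤-trans (+-monoʳ-≤ (R2 q) r≤) (ℚₚ.≤-reflexive (sym (+-assoc (R2 q) _ _))))

OddBound-∷-idle : All (λ p → R2 p ≤ℚ R2 q) l → DescendingR2 l → suc m ≤ length l →
                OddBound m l r → OddBound m (q ∷ l) r
OddBound-∷-idle {m = m} l≤q _ m<n (outside {p} p∈ r≤) = outside (∈-drop-suc⇒∈-drop m p∈)
  (≤-trans r≤ (+-monoˡ-≤ (a p) (prefixR2-mono-∷ l≤q (ℕₚ.<⇒≤ m<n))))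
OddBound-∷-idle {m = m} l≤q l↓ m<n (inside {p} p∈ r≤) with ∈-take-suc m p∈
... | inj₁ p∈take = inside (there p∈take) (≤-trans r≤ (+-monoˡ-≤ (- b p) (prefixR2-suc≤ l≤q m<n)))
... | inj₂ p∈drop = outside p∈drop (≤-trans r≤ (≤-trans (prefixR2-suc-b≤prefixR2+a l↓ m<n p∈)
                      (+-monoˡ-≤ (a p) (prefixR2-mono-∷ l≤q (ℕₚ.<⇒≤ m<n)))))

even-bound : DescendingR2 l → All InGroupB l → ∀ m (x : Alloc l) → effort l x ≡ 2 * m →
             revenue l x ≤ℚ prefixR2 m l
odd-bound : DescendingR2 l → All InGroupB l → ∀ m (x : Alloc l) → effort l x ≡ 2 * m + 1 →
            OddBound m l (revenue l x)

even-bound [] [] zero [] _ = ≤-refl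
even-bound {q ∷ l} (l≤q ∷ l↓) (_ ∷ l∈B) m (0F ∷ xs) e = begin
  0ℚ +ℚ revenue l xs ≡⟨ +-identityˡ _ ⟩
  revenue l xs       ≤⟨ even-bound l↓ l∈B m xs e ⟩
  prefixR2 m l       ≤⟨ prefixR2-mono-∷ {m = m} l≤q (even-effort⇒≤length l xs e) ⟩
  prefixR2 m (q ∷ l) ∎
even-bound {q ∷ l} (l≤q ∷ l↓) (q∈B ∷ l∈B) (suc m) (1F ∷ xs) e
  with OddBound-weaken l↓ (odd-effort⇒<length l xs e′) (odd-bound l↓ l∈B m xs e′)
  where e′ = 1+k≡2*[1+m]⇒k≡2*m+1 m e
... | p , p∈ , r≤ = begin
  a q +ℚ revenue l xs          ≤⟨ +-monoʳ-≤ (a q) r≤ ⟩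
  a q +ℚ (prefixR2 m l +ℚ a p) ≡⟨ x∙yz≈xz∙y (a q) _ (a p) ⟩
  (a q +ℚ a p) +ℚ prefixR2 m l ≤⟨ +-monoˡ-≤ _ (two-singles≤double q∈B (All.lookup l∈B p∈)
                                                                     (All.lookup l≤q p∈)) ⟩
  R2 q +ℚ prefixR2 m l         ∎
even-bound {q ∷ l} (_ ∷ l↓) (_ ∷ l∈B) (suc m) (2F ∷ xs) e =
  +-monoʳ-≤ (R2 q) (even-bound l↓ l∈B m xs (2+k≡2*[1+m]⇒k≡2*m m e))

odd-bound [] [] m [] e = ⊥-elim (ℕₚ.0≢1+n (trans e (2*m+1≡1+2*m m)))
odd-bound {q ∷ l} (l≤q ∷ l↓) (_ ∷ l∈B) m (0F ∷ xs) e = subst (OddBound m (q ∷ l)) (sym (+-identityˡ _))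
  (OddBound-∷-idle {m = m} l≤q l↓ (odd-effort⇒<length l xs e) (odd-bound l↓ l∈B m xs e))
odd-bound {q ∷ l} (_ ∷ l↓) (_ ∷ l∈B) m (1F ∷ xs) e = inside (here refl) (begin
  a q +ℚ revenue l xs             ≤⟨ +-monoʳ-≤ (a q) (even-bound l↓ l∈B m xs (1+k≡2*m+1⇒k≡2*m m e)) ⟩
  a q +ℚ prefixR2 m l             ≡⟨ a+r≡R2+r-b q _ ⟩
  (R2 q +ℚ prefixR2 m l) -ℚ b q   ∎)
odd-bound {q ∷ l} (_ ∷ l↓) (_ ∷ l∈B) (suc m) (2F ∷ xs) e =
  OddBound-∷-double (odd-bound l↓ l∈B m xs (2+k≡2*[1+m]+1⇒k≡2*m+1 m e))

idle-attains : ∀ l → Attains l 0 0ℚ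
idle-attains [] = [] , refl , refl
idle-attains (_ ∷ l) with x , ex , rx ← idle-attains l = 0F ∷ x , ex , trans (+-identityˡ _) rx

single-attains : p ∈ l → Attains l 1 (a p)
single-attains {l = q ∷ l} (here refl) with x , ex , rx ← idle-attains l =
  1F ∷ x , cong suc ex , trans (cong (a q +ℚ_) rx) (+-identityʳ (a q))
single-attains (there p∈) with x , ex , rx ← single-attains p∈ = 0F ∷ x , ex , trans (+-identityˡ _) rx

doubles-attains : m ≤ length l → Attains (drop m l) k v → Attains l (2 * m + k) (prefixR2 m l +ℚ v)
doubles-attains {m = zero} _ (x , ex , rx) = x , ex , trans rx (sym (+-identityˡ _))
doubles-attains {m = suc m} {l = q ∷ l} {k = k} (s≤s m≤n) att with x , ex , rx ← doubles-attains m≤n att =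
  2F ∷ x , trans (cong (suc ∘ suc) ex) (cong (_+ k) (sym (ℕₚ.*-suc 2 m))) ,
  trans (cong (R2 q +ℚ_) rx) (sym (+-assoc (R2 q) _ _))

even-attains : m ≤ length l → Attains l (2 * m) (prefixR2 m l)
even-attains {m} {l} m≤n with x , ex , rx ← doubles-attains m≤n (idle-attains (drop m l)) =
  x , trans ex (ℕₚ.+-identityʳ (2 * m)) , trans rx (+-identityʳ _)

outside-attains : m ≤ length l → p ∈ drop (suc m) l → Attains l (2 * m + 1) (prefixR2 m l +ℚ a p)
outside-attains {m} m≤n p∈ = doubles-attains m≤n (single-attains (∈-drop-suc⇒∈-drop m p∈))

inside-attains : suc m ≤ length l → p ∈ take (suc m) l → Attains l (2 * m + 1) (prefixR2 (suc m) l -ℚ b p)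
inside-attains {m} {q ∷ l} (s≤s m≤n) (here refl) with x , ex , rx ← even-attains m≤n =
  1F ∷ x , trans (cong suc ex) (sym (2*m+1≡1+2*m m)) , trans (cong (a q +ℚ_) rx) (a+r≡R2+r-b q _)
inside-attains {suc m} {q ∷ l} (s≤s m<n) (there p∈) with x , ex , rx ← inside-attains m<n p∈ =
  2F ∷ x , trans (cong (suc ∘ suc) ex) (cong (_+ 1) (sym (ℕₚ.*-suc 2 m))) ,
  trans (cong (R2 q +ℚ_) rx) (sym (+-assoc (R2 q) _ _))

≤+a⇒≤+maxOf : {ps : List Project} → p ∈ ps → r ≤ℚ w +ℚ a p → r ≤ℚ w +ℚ maxOf (map a ps)
≤+a⇒≤+maxOf {w = w} p∈ r≤ = ≤-trans r≤ (+-monoʳ-≤ w (≤-maxOf (∈-map⁺ a p∈)))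

≤-b⇒≤-minOf : {ps : List Project} → p ∈ ps → r ≤ℚ w -ℚ b p → r ≤ℚ w -ℚ minOf (map b ps)
≤-b⇒≤-minOf {w = w} p∈ r≤ = ≤-trans r≤ (+-monoʳ-≤ w (ℚₚ.neg-antimono-≤ (minOf-≤ (∈-map⁺ b p∈))))

outside-maxOf-attains : m ≤ length l → p ∈ drop (suc m) l →
                        Attains l (2 * m + 1) (prefixR2 m l +ℚ maxOf (map a (drop (suc m) l)))
outside-maxOf-attains {m} {l} m≤n p∈ with p′ , p′∈ , eq ← maxOf-attained a p∈ =
  subst (λ v → Attains l (2 * m + 1) (prefixR2 m l +ℚ v)) (sym eq) (outside-attains m≤n p′∈)

inside-minOf-attains : suc m ≤ length l →
                       Attains l (2 * m + 1) (prefixR2 (suc m) l -ℚ minOf (map b (take (suc m) l)))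
inside-minOf-attains {m} {q ∷ l} m<n
  with p , p∈ , eq ← minOf-attained b {as = take (suc m) (q ∷ l)} (here refl) =
  subst (λ v → Attains (q ∷ l) (2 * m + 1) (prefixR2 (suc m) (q ∷ l) -ℚ v)) (sym eq) (inside-attains m<n p∈)

groupB-even-max : DescendingR2 l → All InGroupB l → ∀ m → m ≤ length l → IsMaxRevenue l (2 * m) (prefixR2 m l)
groupB-even-max l↓ l∈B m m≤n = even-attains m≤n , even-bound l↓ l∈B m

groupB-odd-max : DescendingR2 l → All InGroupB l → ∀ m g₀ g₂ → suc (suc m) ≤ length l
  → IsMaxRevenue l (2 * m) g₀
  → IsMaxRevenue l (2 * m + 2) g₂
  → IsMaxRevenue l (2 * m + 1)
      ((g₀ +ℚ maxOf (map a (drop (suc m) l))) ⊔ℚ (g₂ -ℚ minOf (map b (take (suc m) l))))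
groupB-odd-max {l} l↓ l∈B m g₀ g₂ m+1<n g₀-max g₂-max
  with refl ← IsMaxRevenue-unique {l = l} g₀-max (groupB-even-max l↓ l∈B m (ℕₚ.<⇒≤ (ℕₚ.<⇒≤ m+1<n)))
     | refl ← IsMaxRevenue-unique {l = l} (subst (λ k → IsMaxRevenue l k g₂) (2*m+2≡2*[1+m] m) g₂-max)
                                  (groupB-even-max l↓ l∈B (suc m) (ℕₚ.<⇒≤ m+1<n))
  = attains (ℚₚ.⊔-sel _ _) , upper
  where
  m<n : m < length l
  m<n = ℕₚ.<⇒≤ m+1<n

  outsideValue insideValue : ℚ
  outsideValue = prefixR2 m l +ℚ maxOf (map a (drop (suc m) l))
  insideValue = prefixR2 (suc m) l -ℚ minOf (map b (take (suc m) l))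

  upper : ∀ (x : Alloc l) → effort l x ≡ 2 * m + 1 → revenue l x ≤ℚ outsideValue ⊔ℚ insideValue
  upper x e with odd-bound l↓ l∈B m x e
  ... | outside p∈ r≤ = ℚₚ.p≤q⇒p≤q⊔r insideValue (≤+a⇒≤+maxOf {w = prefixR2 m l} p∈ r≤)
  ... | inside p∈ r≤ = ℚₚ.p≤q⇒p≤r⊔q outsideValue (≤-b⇒≤-minOf {w = prefixR2 (suc m) l} p∈ r≤)

  attains : (outsideValue ⊔ℚ insideValue ≡ outsideValue) ⊎ (outsideValue ⊔ℚ insideValue ≡ insideValue) →
            Attains l (2 * m + 1) (outsideValue ⊔ℚ insideValue)
  attains (inj₁ eq) = subst (Attains l _) (sym eq)
    (outside-maxOf-attains (ℕₚ.<⇒≤ m<n) (proj₂ (drop-nonempty {as = l} m+1<n)))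
  attains (inj₂ eq) = subst (Attains l _) (sym eq) (inside-minOf-attains {l = l} m<n)

groupB-odd-max-last : DescendingR2 l → All InGroupB l → ∀ m g₂ → suc m ≡ length l
  → IsMaxRevenue l (2 * m + 2) g₂
  → IsMaxRevenue l (2 * m + 1) (g₂ -ℚ minOf (map b (take (suc m) l)))
groupB-odd-max-last {l} l↓ l∈B m g₂ m+1≡n g₂-max
  with refl ← IsMaxRevenue-unique {l = l} (subst (λ k → IsMaxRevenue l k g₂) (2*m+2≡2*[1+m] m) g₂-max)
                                          (groupB-even-max l↓ l∈B (suc m) (ℕₚ.≤-reflexive m+1≡n))
  = inside-minOf-attains {l = l} (ℕₚ.≤-reflexive m+1≡n) , upper
  where
  upper : ∀ (x : Alloc l) → effort l x ≡ 2 * m + 1 →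
          revenue l x ≤ℚ prefixR2 (suc m) l -ℚ minOf (map b (take (suc m) l))
  upper x e with odd-bound l↓ l∈B m x e
  ... | outside p∈ _ with () ← subst (_ ∈_) (drop-all (suc m) l (ℕₚ.≤-reflexive (sym m+1≡n))) p∈
  ... | inside p∈ r≤ = ≤-b⇒≤-minOf {w = prefixR2 (suc m) l} p∈ r≤

lemma7 : (ps : List Project)
    → Linked (λ p q → R2 q ≤ℚ R2 p) ps
    → (∀ (k : ℕ) → k ≤ 2 * length (groupA ps)
        → IsMaxRevenue (groupA ps) k (sumLargest k (abValues (groupA ps))))
    × (∀ (m : ℕ) → m ≤ length (groupB ps)
        → IsMaxRevenue (groupB ps) (2 * m) (sumℚ (map R2 (take m (groupB ps)))))
    × (∀ (m : ℕ) (g₀ g₂ : ℚ) → suc (suc m) ≤ length (groupB ps)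
        → IsMaxRevenue (groupB ps) (2 * m) g₀
        → IsMaxRevenue (groupB ps) (2 * m + 2) g₂
        → IsMaxRevenue (groupB ps) (2 * m + 1)
            ((g₀ +ℚ maxOf (map a (drop (suc m) (groupB ps))))
              ⊔ℚ (g₂ -ℚ minOf (map b (take (suc m) (groupB ps))))))
    × (∀ (m : ℕ) (g₂ : ℚ) → suc m ≡ length (groupB ps)
        → IsMaxRevenue (groupB ps) (2 * m + 2) g₂
        → IsMaxRevenue (groupB ps) (2 * m + 1)
            (g₂ -ℚ minOf (map b (take (suc m) (groupB ps)))))
lemma7 ps ps↓ =
  groupA-max A∈A , groupB-even-max B↓ B∈B , groupB-odd-max B↓ B∈B , groupB-odd-max-last B↓ B∈B
  where
  A∈A : All InGroupA (groupA ps)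
  A∈A = all-filter (λ p → b p ℚₚ.<? a p) ps
  B∈B : All InGroupB (groupB ps)
  B∈B = all-filter (λ p → a p ℚₚ.≤? b p) ps
  B↓ : DescendingR2 (groupB ps)
  B↓ = AllPairs.filter⁺ (λ p → a p ℚₚ.≤? b p) (Linked⇒AllPairs (λ q≤p r≤q → ℚₚ.≤-trans r≤q q≤p) ps↓)
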